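{- Consider a two-player generalized Zeckendorf game on $n$. Suppose one player (the protagonist) on each of their turns makes the first available move in the priority list $C_3, C_2, C_4, C_5, \ldots, C_k, C_1$, where $C_k$ is the largest combining move that can be made in a game starting with $n$ ones. Then, as long as there are $1$'s remaining in the game state, the protagonist forces the game to progress without any splitting move being made (no splitting move ever becomes available to the other player).
   Context: Let $a_1=1$, $a_2=2$ and $a_{i+1}=i\,a_i+a_{i-1}$ for $i\ge 2$. The generalized Zeckendorf game on $n$: the state is a multiset of terms of the sequence, initially $n$ copies of $a_1=1$. The combining moves are $C_1$: replace two $1$'s by one $2$; and, for $i\ge 2$, $C_i$: if the multiset contains at least $i$ copies of $a_i$ and at least one $a_{i-1}$, replace $i$ copies of $a_i$ and one $a_{i-1}$ by one $a_{i+1}$. The splitting moves are $S_2$: replace three $2$'s by one $1$ and one $5$; and, for $i\ge 3$, $S_i$: if the multiset contains $i+1$ copies of $a_i$, replace them by one $a_{i+1}$, $i-2$ copies of $a_{i-1}$ and one $a_{i-2}$. The two players alternate moves until no move is available; the player making the last move wins. -}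

module Defs where

open import Data.Nat using (ℕ; zero; suc; _+_; _*_; _∸_; _≤_; _<_; _≡ᵇ_)
open import Data.Bool using (Bool; true; false; if_then_else_)
open import Data.Product using (_×_)
open import Data.Sum using (_⊎_)
open import Data.Empty using (⊥)
open import Relation.Binary.PropositionalEquality using (_≡_; _≢_)
open import Relation.Nullary using (¬_)

-- The sequence a_1 = 1, a_2 = 2, a_{i+1} = i a_i + a_{i-1}  (a 0 is a dummy value).
a : ℕ → ℕ
a 0 = 0
a 1 = 1
a 2 = 2
a (suc (suc (suc k))) = (suc (suc k)) * a (suc (suc k)) + a (suc k)

-- A game state (multiset of terms of the sequence) is given by its multiplicity
-- function: s i = number of copies of a_i in the multiset (index 0 unused).
State : Set
State = ℕ → ℕ

adjust : ℕ → (ℕ → ℕ) → State → State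
adjust k f s j = if j ≡ᵇ k then f (s j) else s j

sub : ℕ → ℕ → State → State
sub k m = adjust k (λ x → x ∸ m)

add : ℕ → ℕ → State → State
add k m = adjust k (λ x → x + m)

init : ℕ → State
init n j = if j ≡ᵇ 1 then n else 0

canC : ℕ → State → Set
canC 0 s = ⊥
canC 1 s = 2 ≤ s 1
canC i@(suc (suc k)) s = (i ≤ s i) × (1 ≤ s (suc k))

doC : ℕ → State → State
doC 0 s = s
doC 1 s = add 2 1 (sub 1 2 s)
doC i@(suc (suc k)) s = add (suc i) 1 (sub (suc k) 1 (sub i i s))

canS : ℕ → State → Set
canS 0 s = ⊥
canS 1 s = ⊥
canS 2 s = 3 ≤ s 2
canS i@(suc (suc (suc k))) s = suc i ≤ s i

doS : ℕ → State → State
doS 0 s = s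
doS 1 s = s
doS 2 s = add 3 1 (add 1 1 (sub 2 3 s))
doS i@(suc (suc (suc k))) s =
  add (suc k) 1 (add (suc (suc k)) (suc k) (add (suc i) 1 (sub i (suc i) s)))

-- Priority order on combining moves: C_3, C_2, C_4, C_5, ..., C_1.
-- Before j i : C_j comes strictly before C_i in the priority list.
data Before : ℕ → ℕ → Set where
  b3 : ∀ {i} → i ≢ 3 → Before 3 i
  b2 : ∀ {i} → (4 ≤ i ⊎ i ≡ 1) → Before 2 i
  bk : ∀ {j i} → 4 ≤ j → (j < i ⊎ i ≡ 1) → Before j i

PrioC : ℕ → State → Set
PrioC i s = canC i s × (∀ j → Before j i → ¬ canC j s)

-- Reach n pFirst t s : the state s is reached in the game on n, where the
-- protagonist moves first iff pFirst, it is the protagonist's turn iff t,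
-- the protagonist has followed the priority strategy, the opponent has made
-- arbitrary legal moves, and every move was made from a state containing a 1
-- (i.e. we only follow the game as long as 1's remain).
data Reach (n : ℕ) (pFirst : Bool) : Bool → State → Set where
  start : Reach n pFirst pFirst (init n)
  prot  : ∀ {s} i → Reach n pFirst true s → 1 ≤ s 1 → PrioC i s →
          Reach n pFirst false (doC i s)
  oppC  : ∀ {s} i → Reach n pFirst false s → 1 ≤ s 1 → canC i s →
          Reach n pFirst true (doC i s)
  oppS  : ∀ {s} i → Reach n pFirst false s → 1 ≤ s 1 → canS i s →
          Reach n pFirst true (doS i s)

{-# OPTIONS --safe #-}
-- Call a state tame if a_2 occurs at most twice, every a_k with k ≥ 3 at most k times, and
-- whenever a_{p+1} occurs p + 1 times, either a_p is absent or fewer than p pieces a_2, …, a_p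
-- remain.  Tame states admit no splitting move.  A combining move of the opponent leaves a tame
-- state tame up to one surplus 2 (C_1 adds a 2, every other C_i removes pieces), and the
-- protagonist's priority move removes that surplus: the moves preceding the chosen C_i in the
-- priority list are unavailable, so few 2's are present and below i every full a_{p+1} sits on
-- an empty a_p.
module Submission where

open import Defs
open import Data.Nat using (ℕ; zero; suc; _+_; _∸_; _≤_; _<_; _≤′_; ≤′-refl; ≤′-step; _≡ᵇ_; z≤n; s≤s; _≟_)
open import Data.Nat.Properties
open import Data.Nat.Tactic.RingSolver using (solve-∀)
open import Data.Bool using (Bool; true; false; T)
open import Data.Unit using (tt)
open import Data.Product using (_,_; proj₁; proj₂; Σ-syntax)
open import Data.Sum using (_⊎_; inj₁; inj₂; map; map₂)
open import Data.Empty using (⊥-elim)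
open import Function using (_∘_)
open import Relation.Binary.PropositionalEquality
open import Relation.Nullary using (¬_; yes; no)

m+n<1+o⇒m<o : ∀ {m n o} → 0 < n → m + n < suc o → m < o
m+n<1+o⇒m<o {m} 0<n m+n<1+o = <-≤-trans (m<m+n m 0<n) (≤-pred m+n<1+o)

≤-or-offset : ∀ m p → p ≤ m ⊎ Σ[ j ∈ ℕ ] p ≡ j + suc m
≤-or-offset m       zero    = inj₁ z≤n
≤-or-offset zero    (suc p) = inj₂ (p , +-comm 1 p)
≤-or-offset (suc m) (suc p) with ≤-or-offset m p
... | inj₁ p≤m        = inj₁ (s≤s p≤m)
... | inj₂ (j , refl) = inj₂ (j , sym (+-suc j (suc m)))

adjust-self : ∀ k f s → adjust k f s k ≡ f (s k)
adjust-self k f s with k ≡ᵇ k in eq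
... | true  = refl
... | false = ⊥-elim (subst T eq (≡⇒≡ᵇ k k refl))

adjust-other : ∀ k f s j → j ≢ k → adjust k f s j ≡ s j
adjust-other k f s j j≢k with j ≡ᵇ k in eq
... | true  = ⊥-elim (j≢k (≡ᵇ⇒≡ j k (subst T (sym eq) tt)))
... | false = refl

module _ (m : ℕ) (s : State) where
  private
    i : ℕ
    i = suc (suc m)
    halfway removed : State
    halfway = sub i i s
    removed = sub (suc m) 1 halfway

  doC-above : doC i s (suc i) ≡ s (suc i) + 1
  doC-above = trans (adjust-self (suc i) (_+ 1) removed)
    (cong (_+ 1) (trans (adjust-other (suc m) (_∸ 1) halfway (suc i) λ ())
                        (adjust-other i (_∸ i) s (suc i) λ ())))

  doC-at : doC i s i ≡ s i ∸ i
  doC-at = trans (adjust-other (suc i) (_+ 1) removed i λ ())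
    (trans (adjust-other (suc m) (_∸ 1) halfway i λ ()) (adjust-self i (_∸ i) s))

  doC-below : doC i s (suc m) ≡ s (suc m) ∸ 1
  doC-below = trans (adjust-other (suc i) (_+ 1) removed (suc m) λ ())
    (trans (adjust-self (suc m) (_∸ 1) halfway) (cong (_∸ 1) (adjust-other i (_∸ i) s (suc m) λ ())))

  doC-apart : ∀ {k} → k ≢ suc i → k ≢ i → k ≢ suc m → doC i s k ≡ s k
  doC-apart {k} k≢i+1 k≢i k≢i-1 = trans (adjust-other (suc i) (_+ 1) removed k k≢i+1)
    (trans (adjust-other (suc m) (_∸ 1) halfway k k≢i-1) (adjust-other i (_∸ i) s k k≢i))

  doC-decreases : ∀ {k} → k ≢ suc i → doC i s k ≤ s k
  doC-decreases {k} k≢i+1 with k ≟ i | k ≟ suc m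
  ... | yes refl | _        = ≤-trans (≤-reflexive doC-at) (m∸n≤m _ i)
  ... | no _     | yes refl = ≤-trans (≤-reflexive doC-below) (m∸n≤m _ 1)
  ... | no k≢i   | no k≢i-1 = ≤-reflexive (doC-apart k≢i+1 k≢i k≢i-1)

  doC-agrees-below : ∀ {k} → k ≤ m → doC i s k ≡ s k
  doC-agrees-below k≤m = doC-apart (<⇒≢ (m<n⇒m<1+n k<i)) (<⇒≢ k<i) (<⇒≢ (s≤s k≤m))
    where k<i = m<n⇒m<1+n (s≤s k≤m)

  doC-agrees-above : ∀ {k} → suc i < k → doC i s k ≡ s k
  doC-agrees-above i+1<k = doC-apart (>⇒≢ i+1<k) (>⇒≢ i<k) (>⇒≢ (<-trans (n<1+n _) i<k))
    where i<k = <-trans (n<1+n _) i+1<k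

pieces : State → ℕ → ℕ
pieces s 0 = 0
pieces s 1 = 0
pieces s (suc (suc p)) = pieces s (suc p) + s (suc (suc p))

s≤pieces : ∀ s {k} → 2 ≤ k → s k ≤ pieces s k
s≤pieces s {suc (suc k)} _ = m≤n+m _ _
s≤pieces s {suc zero} (s≤s ())

pieces-cong : ∀ {u s} p → (∀ {k} → k ≤ p → u k ≡ s k) → pieces u p ≡ pieces s p
pieces-cong zero          _     = refl
pieces-cong (suc zero)    _     = refl
pieces-cong (suc (suc p)) agree =
  cong₂ _+_ (pieces-cong (suc p) (agree ∘ m≤n⇒m≤1+n)) (agree ≤-refl)

pieces-shift : ∀ {u s b} c → (∀ {k} → b < k → u k ≡ s k) →
               pieces u b + c ≡ pieces s b → ∀ {p} → b ≤ p → pieces u p + c ≡ pieces s p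
pieces-shift {u} {s} {b} c agree base b≤p = go (≤⇒≤′ b≤p)
  where
  go : ∀ {p} → b ≤′ p → pieces u p + c ≡ pieces s p
  go ≤′-refl                  = base
  go (≤′-step {zero} b≤′0)    = go b≤′0
  go (≤′-step {suc p} b≤′p) = begin
    pieces u (suc p) + u (suc (suc p)) + c ≡⟨ swap (pieces u (suc p)) _ c ⟩
    pieces u (suc p) + c + u (suc (suc p)) ≡⟨ cong₂ _+_ (go b≤′p) (agree (s≤s (≤′⇒≤ b≤′p))) ⟩
    pieces s (suc p) + s (suc (suc p))     ∎
    where
    open ≡-Reasoning
    swap : ∀ x y z → x + y + z ≡ x + z + y
    swap = solve-∀

-- C_p would overfill a full a_{p+1}, so it must stay out of reach.
Guarded : ℕ → State → ℕ → Set
Guarded d s p = s (suc p) ≡ suc p → s p ≡ 0 ⊎ pieces s p < d + p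

-- d counts the surplus 2's allowed: one after the opponent's move, none after the protagonist's.
record Tame (d : ℕ) (s : State) : Set where
  field
    twos    : s 2 ≤ 2 + d
    bounded : ∀ k → 3 ≤ k → s k ≤ k
    guarded : ∀ p → 2 ≤ p → Guarded d s p
open Tame

Tame-weaken : ∀ {d e s} → d ≤ e → Tame d s → Tame e s
Tame-weaken d≤e S = record
  { twos    = ≤-trans (twos S) (+-monoʳ-≤ 2 d≤e)
  ; bounded = bounded S
  ; guarded = λ p 2≤p full → map₂ (λ lt → <-≤-trans lt (+-monoˡ-≤ p d≤e)) (guarded S p 2≤p full)
  }

Tame-init : ∀ d n → Tame d (init n)
Tame-init d n = record { twos = z≤n ; bounded = bounded′ ; guarded = guarded′ }
  where
  bounded′ : ∀ k → 3 ≤ k → init n k ≤ k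
  bounded′ k (s≤s (s≤s (s≤s _))) = z≤n
  guarded′ : ∀ p → 2 ≤ p → Guarded d (init n) p
  guarded′ p (s≤s (s≤s _)) ()

Tame₀⇒¬canS : ∀ {s} → Tame 0 s → ∀ i → ¬ canS i s
Tame₀⇒¬canS S 0 ()
Tame₀⇒¬canS S 1 ()
Tame₀⇒¬canS S 2                     = ≤⇒≯ (twos S)
Tame₀⇒¬canS S i@(suc (suc (suc k))) = ≤⇒≯ (bounded S i (s≤s (s≤s (s≤s z≤n))))

Tame-doC₁ : ∀ {d s} → Tame d s → Tame (suc d) (doC 1 s)
Tame-doC₁ {d} {s} S = record { twos = twos′ ; bounded = bounded′ ; guarded = guarded′ }
  where
  u : State
  u = doC 1 s

  pieces-u : ∀ {p} → 2 ≤ p → pieces s p + 1 ≡ pieces u p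
  pieces-u = pieces-shift 1 agree refl
    where
    agree : ∀ {k} → 2 < k → s k ≡ u k
    agree (s≤s (s≤s (s≤s _))) = refl

  one-more : ∀ {p} → 2 ≤ p → pieces s p < d + p → pieces u p < suc d + p
  one-more {p} 2≤p lt = s≤s (subst (_≤ d + p) (trans (+-comm 1 _) (pieces-u 2≤p)) lt)

  twos′ : s 2 + 1 ≤ 2 + suc d
  twos′ = subst (_≤ 2 + suc d) (+-comm 1 (s 2)) (s≤s (twos S))

  bounded′ : ∀ k → 3 ≤ k → u k ≤ k
  bounded′ k 3≤k@(s≤s (s≤s (s≤s _))) = bounded S k 3≤k

  guarded′ : ∀ p → 2 ≤ p → Guarded (suc d) u p
  guarded′ (suc zero) (s≤s ())
  guarded′ 2 2≤p full with guarded S 2 2≤p full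
  ... | inj₁ no-twos = inj₂ (one-more 2≤p (subst (_< d + 2) (sym no-twos) (≤-trans (s≤s z≤n) (m≤n+m 2 d))))
  ... | inj₂ lt      = inj₂ (one-more 2≤p lt)
  guarded′ p@(suc (suc (suc _))) 2≤p full = map₂ (one-more 2≤p) (guarded S p 2≤p full)

Tame-doC₂ : ∀ {t} → Tame 1 t → canC 2 t → t 3 ≤ 2 → Tame 0 (doC 2 t)
Tame-doC₂ {t} T (2≤t₂ , _) t₃≤2 = record { twos = twos′ ; bounded = bounded′ ; guarded = guarded′ }
  where
  u : State
  u = doC 2 t

  pieces-u : ∀ {p} → 3 ≤ p → pieces u p + 1 ≡ pieces t p
  pieces-u = pieces-shift 1 agree base
    where
    agree : ∀ {k} → 3 < k → u k ≡ t k
    agree (s≤s (s≤s (s≤s (s≤s _)))) = refl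
    rearrange : ∀ a b → a + (b + 1) + 1 ≡ a + 2 + b
    rearrange = solve-∀
    base : pieces u 3 + 1 ≡ pieces t 3
    base = trans (rearrange (t 2 ∸ 2) (t 3)) (cong (_+ t 3) (m∸n+n≡m 2≤t₂))

  fewer : ∀ {p} → 3 ≤ p → pieces t p < 1 + p → pieces u p < p
  fewer 3≤p lt = m+n<1+o⇒m<o (s≤s z≤n) (subst (_< 1 + _) (sym (pieces-u 3≤p)) lt)

  t₂∸2≤1 : t 2 ∸ 2 ≤ 1
  t₂∸2≤1 = ∸-monoˡ-≤ 2 (twos T)

  twos′ : u 2 ≤ 2
  twos′ = m≤n⇒m≤1+n t₂∸2≤1

  bounded′ : ∀ k → 3 ≤ k → u k ≤ k
  bounded′ 1 (s≤s ())
  bounded′ 2 (s≤s (s≤s ()))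
  bounded′ 3 _ = subst (_≤ 3) (+-comm 1 (t 3)) (s≤s t₃≤2)
  bounded′ k@(suc (suc (suc (suc _)))) = bounded T k

  guarded′ : ∀ p → 2 ≤ p → Guarded 0 u p
  guarded′ 1 (s≤s ())
  guarded′ 2 _ _ = inj₂ (s≤s t₂∸2≤1)
  guarded′ 3 3≤p full with guarded T 3 3≤p full
  ... | inj₁ no-threes = inj₂ (fewer ≤-refl (s≤s (≤-trans (≤-reflexive pieces-t) (twos T))))
    where
    pieces-t : pieces t 3 ≡ t 2
    pieces-t = trans (cong (t 2 +_) no-threes) (+-identityʳ (t 2))
  ... | inj₂ lt        = inj₂ (fewer ≤-refl lt)
  guarded′ p@(suc (suc (suc (suc _)))) 2≤p full =
    map₂ (fewer (s≤s (s≤s (s≤s z≤n)))) (guarded T p 2≤p full)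

module _ {t : State} (T : Tame 1 t) (m : ℕ) (c : canC (3 + m) t) where
  private
    i : ℕ
    i = 3 + m
    u : State
    u = doC i t

    t-at : t i ≡ i
    t-at = ≤-antisym (bounded T i (s≤s (s≤s (s≤s z≤n)))) (proj₁ c)

    u-at : u i ≡ 0
    u-at = trans (doC-at (suc m) t) (trans (cong (_∸ i) t-at) (n∸n≡0 i))

    pieces-t-before : pieces t (2 + m) < i
    pieces-t-before with guarded T (2 + m) (s≤s (s≤s z≤n)) t-at
    ... | inj₁ none = ⊥-elim (≤⇒≯ (≤-reflexive none) (proj₂ c))
    ... | inj₂ lt   = lt

    t-after : t (suc i) ≤ i
    t-after = ≤-pred (≤∧≢⇒< (bounded T (suc i) (s≤s (s≤s (s≤s z≤n)))) not-full)
      where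
      not-full : t (suc i) ≢ suc i
      not-full full with guarded T i (s≤s (s≤s z≤n)) full
      ... | inj₁ none = 1+n≢0 (trans (sym t-at) none)
      ... | inj₂ lt   = ≤⇒≯ (+-mono-≤ (≤-trans (proj₂ c) (s≤pieces t (s≤s (s≤s z≤n)))) (proj₁ c)) lt

    pieces-u-after : pieces u (suc i) + i ≡ pieces t (suc i)
    pieces-u-after = begin
      pieces u (suc m) + u (2 + m) + u i + u (suc i) + i
        ≡⟨ cong (_+ i) (cong₂ _+_ (cong₂ _+_ (cong₂ _+_ below (doC-below (suc m) t)) u-at) (doC-above (suc m) t)) ⟩
      pieces t (suc m) + (t (2 + m) ∸ 1) + 0 + (t (suc i) + 1) + i
        ≡⟨ rearrange (pieces t (suc m)) (t (2 + m) ∸ 1) (t (suc i)) i ⟩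
      pieces t (suc m) + (t (2 + m) ∸ 1 + 1) + i + t (suc i)
        ≡⟨ cong (λ x → pieces t (suc m) + x + i + t (suc i)) (m∸n+n≡m (proj₂ c)) ⟩
      pieces t (suc m) + t (2 + m) + i + t (suc i)
        ≡⟨ cong (λ x → pieces t (suc m) + t (2 + m) + x + t (suc i)) t-at ⟨
      pieces t (suc i) ∎
      where
      open ≡-Reasoning
      below : pieces u (suc m) ≡ pieces t (suc m)
      below = pieces-cong (suc m) (doC-agrees-below (suc m) t)
      rearrange : ∀ a b c n → a + b + 0 + (c + 1) + n ≡ a + (b + 1) + n + c
      rearrange = solve-∀

    fewer : ∀ {p} → suc i ≤ p → pieces t p < 1 + p → pieces u p < p
    fewer i<p lt = m+n<1+o⇒m<o (s≤s z≤n)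
      (subst (_< 1 + _) (sym (pieces-shift i (doC-agrees-above (suc m) t) pieces-u-after i<p)) lt)

    bounded′ : ∀ k → 3 ≤ k → u k ≤ k
    bounded′ k 3≤k with k ≟ suc i
    ... | yes refl = ≤-trans (≤-reflexive (doC-above (suc m) t)) (subst (_≤ suc i) (+-comm 1 _) (s≤s t-after))
    ... | no k≢i+1 = ≤-trans (doC-decreases (suc m) t k≢i+1) (bounded T k 3≤k)

    guarded′ : (∀ p → 2 ≤ p → p ≤ m → Guarded 0 t p) → ∀ p → 2 ≤ p → Guarded 0 u p
    guarded′ low p 2≤p full with ≤-or-offset m p
    ... | inj₁ p≤m = map (trans (doC-agrees-below (suc m) t (m≤n⇒m≤1+n p≤m)))
                         (subst (_< p) (sym (pieces-cong p λ k≤p → doC-agrees-below (suc m) t (≤-trans k≤p (m≤n⇒m≤1+n p≤m)))))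
                         (low p 2≤p p≤m (trans (sym (doC-agrees-below (suc m) t (s≤s p≤m))) full))
    ... | inj₂ (0 , refl) = ⊥-elim (1+n≰n (subst (_≤ suc m) (trans (sym (doC-below (suc m) t)) full)
                                              (∸-monoˡ-≤ 1 (bounded T (2 + m) (s≤s 2≤p)))))
    ... | inj₂ (1 , refl) = ⊥-elim (0≢1+n (trans (sym u-at) full))
    ... | inj₂ (2 , refl) = inj₁ u-at
    ... | inj₂ (3 , refl) with guarded T (suc i) 2≤p (trans (sym (doC-agrees-above (suc m) t ≤-refl)) full)
    ...   | inj₂ lt   = inj₂ (fewer ≤-refl lt)
    ...   | inj₁ none = inj₂ (<-trans (subst (_< i) (sym same) pieces-t-before) (n<1+n i))
      where
      same : pieces u (suc i) ≡ pieces t (2 + m)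
      same = +-cancelʳ-≡ i _ _ (trans pieces-u-after
               (trans (cong₂ _+_ (cong (pieces t (2 + m) +_) t-at) none) (+-identityʳ _)))
    guarded′ low p 2≤p full | inj₂ (suc (suc (suc (suc j))) , refl) =
      map (trans (doC-agrees-above (suc m) t i+1<p)) (fewer (<⇒≤ i+1<p))
          (guarded T p 2≤p (trans (sym (doC-agrees-above (suc m) t (m<n⇒m<1+n i+1<p))) full))
      where
      i+1<p : suc i < p
      i+1<p = s≤s (s≤s (s≤s (s≤s (m≤n+m (suc m) j))))

  -- Positions p ≤ i - 3 are untouched by C_i, so their guardedness must come from the caller.
  Tame-doC : doC i t 2 ≤ 2 → (∀ p → 2 ≤ p → p ≤ m → Guarded 0 t p) → Tame 0 (doC i t)
  Tame-doC twos′ low = record { twos = twos′ ; bounded = bounded′ ; guarded = guarded′ low }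

module _ {i : ℕ} {t : State} (earlier-unavailable : ∀ j → Before j i → ¬ canC j t) where

  empty-below-full : ∀ p → Before (suc p) i → t (suc p) ≡ suc p → t p ≡ 0
  empty-below-full zero    (bk (s≤s ()) _)
  empty-below-full (suc p) before full =
    n<1⇒n≡0 (≰⇒> λ 1≤tp → earlier-unavailable (suc (suc p)) before (≤-reflexive (sym full) , 1≤tp))

  few-twos : 1 ≤ t 1 → Before 2 i → t 2 ≤ 1
  few-twos ones before = ≤-pred (≰⇒> λ 2≤t₂ → earlier-unavailable 2 before (2≤t₂ , ones))

Before-below : ∀ m p → 2 ≤ p → p ≤ m → Before (suc p) (3 + m)
Before-below m               (suc zero)          (s≤s ())
Before-below zero            2                   _ ()
Before-below (suc zero)      2                   _ (s≤s ())
Before-below (suc (suc m))   2                   _ _   = b3 λ ()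
Before-below m               (suc (suc (suc p))) _ p≤m =
  bk (s≤s (s≤s (s≤s (s≤s z≤n)))) (inj₁ (m≤n⇒m≤1+n (s≤s (s≤s p≤m))))

Tame-doC₁-last : ∀ {t} → Tame 1 t → 1 ≤ t 1 → (∀ j → Before j 1 → ¬ canC j t) → Tame 0 (doC 1 t)
Tame-doC₁-last {t} T ones earlier = record { twos = twos′ ; bounded = bounded′ ; guarded = guarded′ }
  where
  u : State
  u = doC 1 t

  twos′ : t 2 + 1 ≤ 2
  twos′ = subst (_≤ 2) (+-comm 1 (t 2)) (s≤s (few-twos earlier ones (b2 (inj₂ refl))))

  bounded′ : ∀ k → 3 ≤ k → u k ≤ k
  bounded′ k 3≤k@(s≤s (s≤s (s≤s _))) = bounded T k 3≤k

  guarded′ : ∀ p → 2 ≤ p → Guarded 0 u p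
  guarded′ 1 (s≤s ())
  guarded′ 2 _ full = inj₂ (subst (λ x → x + 1 < 2) (sym (empty-below-full earlier 2 (b3 λ ()) full)) ≤-refl)
  guarded′ p@(suc (suc (suc _))) _ full =
    inj₁ (empty-below-full earlier p (bk (s≤s (s≤s (s≤s (s≤s z≤n)))) (inj₂ refl)) full)

opponent-combines : ∀ {s} i → Tame 0 s → canC i s → Tame 1 (doC i s)
opponent-combines 1 S _ = Tame-doC₁ S
opponent-combines {s} 2 S c@(2≤s₂ , _) =
  Tame-weaken z≤n (Tame-doC₂ (Tame-weaken z≤n S) c (≤-pred (≤∧≢⇒< (bounded S 3 ≤-refl) not-full)))
  where
  not-full : s 3 ≢ 3
  not-full full with guarded S 2 ≤-refl full
  ... | inj₁ none = ≤⇒≯ (≤-reflexive none) (≤-trans (s≤s z≤n) 2≤s₂)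
  ... | inj₂ lt   = ≤⇒≯ 2≤s₂ lt
opponent-combines {s} (suc (suc (suc m))) S c =
  Tame-weaken z≤n (Tame-doC (Tame-weaken z≤n S) m c (≤-trans (doC-decreases (suc m) s {2} λ ()) (twos S))
                            (λ p 2≤p _ → guarded S p 2≤p))

protagonist-replies : ∀ {t} i → Tame 1 t → 1 ≤ t 1 → PrioC i t → Tame 0 (doC i t)
protagonist-replies 1 T ones (_ , earlier) = Tame-doC₁-last T ones earlier
protagonist-replies {t} 2 T _ (c@(2≤t₂ , _) , earlier) =
  Tame-doC₂ T c (≤-pred (≤∧≢⇒< (bounded T 3 ≤-refl) not-full))
  where
  not-full : t 3 ≢ 3
  not-full full = ≤⇒≯ (≤-reflexive (empty-below-full earlier 2 (b3 λ ()) full)) (≤-trans (s≤s z≤n) 2≤t₂)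
protagonist-replies 3 T _ (c , _) =
  Tame-doC T 0 c (∸-monoˡ-≤ 1 (twos T)) λ _ 2≤p p≤0 → ⊥-elim (≤⇒≯ p≤0 (≤-trans (s≤s z≤n) 2≤p))
protagonist-replies (suc (suc (suc (suc m)))) T ones (c , earlier) =
  Tame-doC T (suc m) c (m≤n⇒m≤1+n (few-twos earlier ones (b2 (inj₁ (s≤s (s≤s (s≤s (s≤s z≤n))))))))
    λ p 2≤p p≤m full → inj₁ (empty-below-full earlier p (Before-below (suc m) p 2≤p p≤m) full)

surplus : Bool → ℕ
surplus true  = 1
surplus false = 0

Reach⇒Tame : ∀ {n pFirst turn s} → Reach n pFirst turn s → Tame (surplus turn) s
Reach⇒Tame start            = Tame-init _ _
Reach⇒Tame (prot i r ones p) = protagonist-replies i (Reach⇒Tame r) ones p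
Reach⇒Tame (oppC i r _ c)    = opponent-combines i (Reach⇒Tame r) c
Reach⇒Tame (oppS i r _ c)    = ⊥-elim (Tame₀⇒¬canS (Reach⇒Tame r) i c)

theorem7p4 : (n : ℕ) (pFirst : Bool) (s : State) →
    Reach n pFirst false s → 1 ≤ s 1 → (i : ℕ) → ¬ canS i s
theorem7p4 n pFirst s r _ = Tame₀⇒¬canS (Reach⇒Tame r)
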